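{- Let $\mathcal{A}=\left(\frac{ -a,-b}{\mathbb{Q}}\right)$ be a rational quaternion division algebra with $a,b>0$, and let $H$ be an order in $\mathcal{A}$. Suppose $H$ is a left principal ideal domain. Let $\theta\in H$ be primitive and let $m\in\mathbb{N}$ with $m\mid \mathrm{N}(\theta)$. Then there exists $\gamma\in H$ with $\mathrm{N}(\gamma)=m$ which is a right divisor of $\theta$ (i.e. $\theta=f\gamma$ for some $f\in H$), and any right divisor $\delta\in H$ of $\theta$ with $\mathrm{N}(\delta)=m$ is a left associate of $\gamma$ (i.e. $\gamma=u\delta$ for some unit $u$ of $H$). Symmetrically, if $H$ is a right principal ideal domain, then $\theta$ has a left divisor of norm $m$, unique up to right associates.
   Context: $\mathcal{A}$ has $\mathbb{Q}$-basis $1,i,j,k$ with $i^2=-a$, $j^2=-b$, $k=ij=-ji$; the conjugate of $\alpha=x_0+x_1i+x_2j+x_3k$ is $\overline{\alpha}=x_0-x_1i-x_2j-x_3k$ and the norm is $\mathrm{N}(\alpha)=\alpha\overline{\alpha}=x_0^2+ax_1^2+bx_2^2+abx_3^2$. An order $H$ is a subring of $\mathcal{A}$ containing $1$ which is a finitely generated $\mathbb{Z}$-module with $H\otimes_{\mathbb{Z}}\mathbb{Q}=\mathcal{A}$. $H$ is a left (right) principal ideal domain if every left (right) ideal of $H$ is of the form $H\gamma$ ($\gamma H$). An element $\theta\in H$ is primitive if there is no integer $n\neq\pm1$ with $\theta/n\in H$. -}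

module Defs where

open import Level using (0ℓ)
open import Data.Nat using (ℕ)
open import Data.Integer using (ℤ; +_) renaming (-_ to -ℤ_)
open import Data.Rational using (ℚ; _+_; _*_; _-_; -_; 0ℚ; 1ℚ; _/_; Positive)
open import Data.Vec using (Vec; []; _∷_; zipWith; foldr)
open import Data.Vec.Relation.Unary.All using (All)
open import Data.Product using (Σ; ∃; _×_; _,_)
open import Data.Sum using (_⊎_)
open import Relation.Binary.PropositionalEquality using (_≡_)

-- Elements x0 + x1 i + x2 j + x3 k of the rational quaternion algebra (-a,-b / ℚ).
record Quat : Set where
  constructor quat
  field
    x₀ x₁ x₂ x₃ : ℚ
open Quat public

ℤ→ℚ : ℤ → ℚ
ℤ→ℚ n = n / 1

module QuatAlg (a b : ℚ) where

  0H : Quat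
  0H = quat 0ℚ 0ℚ 0ℚ 0ℚ

  1H : Quat
  1H = quat 1ℚ 0ℚ 0ℚ 0ℚ

  _⊕_ : Quat → Quat → Quat
  quat x0 x1 x2 x3 ⊕ quat y0 y1 y2 y3 = quat (x0 + y0) (x1 + y1) (x2 + y2) (x3 + y3)

  ⊖_ : Quat → Quat
  ⊖ quat x0 x1 x2 x3 = quat (- x0) (- x1) (- x2) (- x3)

  _·_ : ℚ → Quat → Quat
  q · quat x0 x1 x2 x3 = quat (q * x0) (q * x1) (q * x2) (q * x3)

  -- multiplication determined by i² = -a, j² = -b, k = ij = -ji
  _⊗_ : Quat → Quat → Quat
  quat x0 x1 x2 x3 ⊗ quat y0 y1 y2 y3 = quat
    (x0 * y0 - a * (x1 * y1) - b * (x2 * y2) - (a * b) * (x3 * y3))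
    (x0 * y1 + x1 * y0 + b * (x2 * y3 - x3 * y2))
    (x0 * y2 + x2 * y0 + a * (x3 * y1 - x1 * y3))
    (x0 * y3 + x3 * y0 + x1 * y2 - x2 * y1)

  conj : Quat → Quat
  conj (quat x0 x1 x2 x3) = quat x0 (- x1) (- x2) (- x3)

  N : Quat → ℚ
  N (quat x0 x1 x2 x3) = x0 * x0 + a * (x1 * x1) + b * (x2 * x2) + (a * b) * (x3 * x3)

  Σq : ∀ {n} → Vec Quat n → Quat
  Σq = foldr _ _⊕_ 0H

  -- An order: a subring containing 1, finitely generated as a ℤ-module,
  -- with H ⊗ ℚ = A (i.e. the ℚ-span of H is all of A).
  record IsOrder (H : Quat → Set) : Set where
    field
      zero∈  : H 0H
      one∈   : H 1H
      add∈   : ∀ {x y} → H x → H y → H (x ⊕ y)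
      neg∈   : ∀ {x} → H x → H (⊖ x)
      mul∈   : ∀ {x y} → H x → H y → H (x ⊗ y)
      fingen : Σ ℕ λ n → Σ (Vec Quat n) λ gs → All H gs ×
                 (∀ x → H x → Σ (Vec ℤ n) λ cs → x ≡ Σq (zipWith (λ c g → ℤ→ℚ c · g) cs gs))
      spans  : ∀ α → Σ ℕ λ n → Σ (Vec Quat n) λ hs → All H hs ×
                 Σ (Vec ℚ n) λ qs → α ≡ Σq (zipWith _·_ qs hs)

  record IsLeftIdeal (H I : Quat → Set) : Set where
    field
      sub   : ∀ {x} → I x → H x
      zero∈ : I 0H
      add∈  : ∀ {x y} → I x → I y → I (x ⊕ y)
      neg∈  : ∀ {x} → I x → I (⊖ x)
      lmul∈ : ∀ {h x} → H h → I x → I (h ⊗ x)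

  record IsRightIdeal (H I : Quat → Set) : Set where
    field
      sub   : ∀ {x} → I x → H x
      zero∈ : I 0H
      add∈  : ∀ {x y} → I x → I y → I (x ⊕ y)
      neg∈  : ∀ {x} → I x → I (⊖ x)
      rmul∈ : ∀ {h x} → H h → I x → I (x ⊗ h)

  IsLeftPID : (Quat → Set) → Set₁
  IsLeftPID H = ∀ (I : Quat → Set) → IsLeftIdeal H I →
    Σ Quat λ γ → H γ × (∀ x → (I x → Σ Quat λ h → H h × x ≡ h ⊗ γ)
                            × ((Σ Quat λ h → H h × x ≡ h ⊗ γ) → I x))

  IsRightPID : (Quat → Set) → Set₁
  IsRightPID H = ∀ (I : Quat → Set) → IsRightIdeal H I →
    Σ Quat λ γ → H γ × (∀ x → (I x → Σ Quat λ h → H h × x ≡ γ ⊗ h)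
                            × ((Σ Quat λ h → H h × x ≡ γ ⊗ h) → I x))

  -- θ ∈ H is primitive: no integer n ≠ ±1 with θ/n ∈ H
  -- (θ/n ∈ H written as: θ = n·η for some η ∈ H)
  Primitive : (Quat → Set) → Quat → Set
  Primitive H θ = H θ × (∀ (n : ℤ) (η : Quat) → H η → θ ≡ ℤ→ℚ n · η →
                           (n ≡ + 1) ⊎ (n ≡ -ℤ (+ 1)))

  IsUnit : (Quat → Set) → Quat → Set
  IsUnit H u = H u × Σ Quat λ v → H v × (u ⊗ v ≡ 1H) × (v ⊗ u ≡ 1H)

  RightDivides : (Quat → Set) → Quat → Quat → Set
  RightDivides H δ θ = Σ Quat λ f → H f × θ ≡ f ⊗ δ

  LeftDivides : (Quat → Set) → Quat → Quat → Set
  LeftDivides H δ θ = Σ Quat λ f → H f × θ ≡ δ ⊗ f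

  _∣N_ : ℕ → Quat → Set
  m ∣N θ = Σ ℤ λ k → N θ ≡ ℤ→ℚ (+ m) * ℤ→ℚ k

-- Elements of an order have integral norm and trace: the coordinates of elements of H have a
-- common bounded denominator D, so D′·N(x)ᵏ = D′·N(xᵏ) ∈ ℤ for every k (D′ depending only on D,
-- a and b), which forces N(x) ∈ ℤ; then 2x₀ = N(x + 1) − N(x) − 1 ∈ ℤ, so x̄ = 2x₀ − x ∈ H.
--
-- Let p be a prime dividing N(θ) and write the left ideal Hθ + Hp as Hγ. From θ = fγ and
-- p = gγ we get N(g)N(γ) = p². If N(γ) = 1 then 1 = γ̄γ ∈ Hθ + Hp, and multiplying
-- 1 = xθ + yp on the right by θ̄ shows θ̄ ∈ pH; if N(g) = 1 then γ = pḡ and θ = p·fḡ. Both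
-- contradict primitivity, so N(γ) = p. The cofactor f is again primitive with (m/p) ∣ N(f), and
-- composing along the prime factorisation of m gives a right divisor γ of θ of norm m with
-- γ ∈ Hθ + Hm. If θ = f′δ with N(δ) = m, then γ = xθ + ym = (xf′ + yδ̄)δ and xf′ + yδ̄ has
-- norm 1, i.e. it is a unit. Conjugation, an anti-automorphism of H, turns right divisors
-- into left divisors and right ideals into left ideals, which gives the second half.

{-# OPTIONS --safe #-}
module Submission where

open import Defs
open import Algebra.Bundles using (CommutativeMonoid)
open import Data.Empty using (⊥-elim)
open import Data.Integer using (ℤ; +_; -[1+_]; ∣_∣)
import Data.Integer as ℤ
import Data.Integer.Properties as ℤ
open import Data.List using ([]; _∷_)
open import Data.List.Relation.Unary.All using (All; []; _∷_)
open import Data.Nat using (ℕ; zero; suc)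
import Data.Nat as ℕ
import Data.Nat.Properties as ℕ
open import Data.Nat.Coprimality using (Coprime; coprime-divisor; 1-coprimeTo; recompute)
import Data.Nat.Coprimality as Coprime
open import Data.Nat.Divisibility using (_∣_; divides; ∣-trans; ∣⇒≤; m∣m*n; n∣m*n; *-monoˡ-∣)
open import Data.Nat.ListAction using (product)
open import Data.Nat.Primality using (Prime; euclidsLemma; prime⇒irreducible; prime⇒nonZero; ¬prime[1])
open import Data.Nat.Primality.Factorisation using (factorise; PrimeFactorisation)
open import Data.Product using (Σ; ∃; _×_; _,_; proj₁; proj₂)
open import Data.Rational
  using ( ℚ; mkℚ; _+_; _*_; -_; 0ℚ; 1ℚ; toℚᵘ; ↥_; ↧_; ↧ₙ_; NonZero; Positive; Negative; _≤_; 1/_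
        ; ≢-nonZero; nonNegative; nonPositive)
import Data.Rational.Properties as ℚ
open import Data.Rational.Solver using (module +-*-Solver)
open import Data.Rational.Unnormalised as ℚᵘ using (mkℚᵘ; *≡*)
import Data.Rational.Unnormalised.Properties as ℚᵘ
open import Data.Sum using (_⊎_; inj₁; inj₂)
open import Data.Vec using (Vec; []; _∷_; zipWith)
open import Function using (case_of_)
open import Relation.Binary.PropositionalEquality
open import Relation.Nullary using (yes; no; contradiction)

open +-*-Solver using (con; _:+_; _:*_; :-_; _:-_; _:=_; solve)
open import Algebra.Properties.CommutativeSemigroup
  (CommutativeMonoid.commutativeSemigroup ℚ.*-1-commutativeMonoid) using (interchange; x∙yz≈y∙xz)

-- Integers and denominators in ℚ

ℤ→ℚ≡mkℚ : ∀ z → ℤ→ℚ z ≡ mkℚ z 0 (Coprime.sym (1-coprimeTo ∣ z ∣))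
ℤ→ℚ≡mkℚ z = ℚ.↥p/↧p≡p (mkℚ z 0 _)

toℚᵘ-ℤ→ℚ : ∀ z → toℚᵘ (ℤ→ℚ z) ≡ mkℚᵘ z 0
toℚᵘ-ℤ→ℚ z = cong toℚᵘ (ℤ→ℚ≡mkℚ z)

↥-ℤ→ℚ : ∀ z → ↥ (ℤ→ℚ z) ≡ z
↥-ℤ→ℚ z = cong ↥_ (ℤ→ℚ≡mkℚ z)

ℤ→ℚ-injective : ∀ {m n} → ℤ→ℚ m ≡ ℤ→ℚ n → m ≡ n
ℤ→ℚ-injective {m} {n} eq = trans (sym (↥-ℤ→ℚ m)) (trans (cong ↥_ eq) (↥-ℤ→ℚ n))

module _ where
  open ℚᵘ.≃-Reasoning

  ℤ→ℚ-+ : ∀ m n → ℤ→ℚ (m ℤ.+ n) ≡ ℤ→ℚ m + ℤ→ℚ n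
  ℤ→ℚ-+ m n = ℚ.toℚᵘ-injective (begin
    toℚᵘ (ℤ→ℚ (m ℤ.+ n))             ≡⟨ toℚᵘ-ℤ→ℚ (m ℤ.+ n) ⟩
    mkℚᵘ (m ℤ.+ n) 0                 ≈⟨ *≡* cross-multiplied ⟩
    mkℚᵘ m 0 ℚᵘ.+ mkℚᵘ n 0           ≡⟨ cong₂ ℚᵘ._+_ (toℚᵘ-ℤ→ℚ m) (toℚᵘ-ℤ→ℚ n) ⟨
    toℚᵘ (ℤ→ℚ m) ℚᵘ.+ toℚᵘ (ℤ→ℚ n)   ≈⟨ ℚ.toℚᵘ-homo-+ (ℤ→ℚ m) (ℤ→ℚ n) ⟨
    toℚᵘ (ℤ→ℚ m + ℤ→ℚ n)             ∎)
    where
    cross-multiplied : (m ℤ.+ n) ℤ.* + 1 ≡ (m ℤ.* + 1 ℤ.+ n ℤ.* + 1) ℤ.* + 1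
    cross-multiplied = cong (ℤ._* + 1) (sym (cong₂ ℤ._+_ (ℤ.*-identityʳ m) (ℤ.*-identityʳ n)))

  ℤ→ℚ-* : ∀ m n → ℤ→ℚ (m ℤ.* n) ≡ ℤ→ℚ m * ℤ→ℚ n
  ℤ→ℚ-* m n = ℚ.toℚᵘ-injective (begin
    toℚᵘ (ℤ→ℚ (m ℤ.* n))             ≡⟨ toℚᵘ-ℤ→ℚ (m ℤ.* n) ⟩
    mkℚᵘ m 0 ℚᵘ.* mkℚᵘ n 0           ≡⟨ cong₂ ℚᵘ._*_ (toℚᵘ-ℤ→ℚ m) (toℚᵘ-ℤ→ℚ n) ⟨
    toℚᵘ (ℤ→ℚ m) ℚᵘ.* toℚᵘ (ℤ→ℚ n)   ≈⟨ ℚ.toℚᵘ-homo-* (ℤ→ℚ m) (ℤ→ℚ n) ⟨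
    toℚᵘ (ℤ→ℚ m * ℤ→ℚ n)             ∎)

  ℤ→ℚ-neg : ∀ m → ℤ→ℚ (ℤ.- m) ≡ - ℤ→ℚ m
  ℤ→ℚ-neg m = ℚ.toℚᵘ-injective (begin
    toℚᵘ (ℤ→ℚ (ℤ.- m))   ≡⟨ toℚᵘ-ℤ→ℚ (ℤ.- m) ⟩
    ℚᵘ.- mkℚᵘ m 0        ≡⟨ cong ℚᵘ.-_ (toℚᵘ-ℤ→ℚ m) ⟨
    ℚᵘ.- toℚᵘ (ℤ→ℚ m)    ≈⟨ ℚ.toℚᵘ-homo‿- (ℤ→ℚ m) ⟨
    toℚᵘ (- ℤ→ℚ m)       ∎)

  ↧*≡↥ : ∀ q → ℤ→ℚ (↧ q) * q ≡ ℤ→ℚ (↥ q)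
  ↧*≡↥ q@(mkℚ n d _) = ℚ.toℚᵘ-injective (begin
    toℚᵘ (ℤ→ℚ (↧ q) * q)             ≈⟨ ℚ.toℚᵘ-homo-* (ℤ→ℚ (↧ q)) q ⟩
    toℚᵘ (ℤ→ℚ (↧ q)) ℚᵘ.* mkℚᵘ n d   ≡⟨ cong (ℚᵘ._* mkℚᵘ n d) (toℚᵘ-ℤ→ℚ (↧ q)) ⟩
    mkℚᵘ (↧ q) 0 ℚᵘ.* mkℚᵘ n d       ≈⟨ *≡* cross-multiplied ⟩
    mkℚᵘ n 0                         ≡⟨ toℚᵘ-ℤ→ℚ n ⟨
    toℚᵘ (ℤ→ℚ (↥ q))                 ∎)
    where
    cross-multiplied : (+ suc d ℤ.* n) ℤ.* + 1 ≡ n ℤ.* + suc (d ℕ.+ 0)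
    cross-multiplied = trans (ℤ.*-identityʳ _)
      (trans (ℤ.*-comm (+ suc d) n) (cong (λ k → n ℤ.* + suc k) (sym (ℕ.+-identityʳ d))))

ℕ→ℚ : ℕ → ℚ
ℕ→ℚ n = ℤ→ℚ (+ n)

ℕ→ℚ-* : ∀ m n → ℕ→ℚ (m ℕ.* n) ≡ ℕ→ℚ m * ℕ→ℚ n
ℕ→ℚ-* m n = trans (cong ℤ→ℚ (ℤ.pos-* m n)) (ℤ→ℚ-* (+ m) (+ n))

ℕ→ℚ-injective : ∀ {m n} → ℕ→ℚ m ≡ ℕ→ℚ n → m ≡ n
ℕ→ℚ-injective eq = ℤ.+-injective (ℤ→ℚ-injective eq)

ℕ→ℚ-nonZero : ∀ m .{{_ : ℕ.NonZero m}} → NonZero (ℕ→ℚ m)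
ℕ→ℚ-nonZero (suc m) = subst NonZero (sym (ℤ→ℚ≡mkℚ (+ suc m))) _

IsInteger : ℚ → Set
IsInteger q = ∃ λ z → q ≡ ℤ→ℚ z

ℤ→ℚ-isInteger : ∀ z → IsInteger (ℤ→ℚ z)
ℤ→ℚ-isInteger z = z , refl

isInteger-+ : ∀ {p q} → IsInteger p → IsInteger q → IsInteger (p + q)
isInteger-+ (m , refl) (n , refl) = m ℤ.+ n , sym (ℤ→ℚ-+ m n)

isInteger-* : ∀ {p q} → IsInteger p → IsInteger q → IsInteger (p * q)
isInteger-* (m , refl) (n , refl) = m ℤ.* n , sym (ℤ→ℚ-* m n)

isInteger-neg : ∀ {p} → IsInteger p → IsInteger (- p)
isInteger-neg (m , refl) = ℤ.- m , sym (ℤ→ℚ-neg m)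

infix 4 _clears_
record _clears_ (D : ℕ) (q : ℚ) : Set where
  constructor clearing
  field integral : IsInteger (ℕ→ℚ D * q)

clears-+ : ∀ {D p q} → D clears p → D clears q → D clears (p + q)
clears-+ {D} {p} {q} (clearing Dp) (clearing Dq) =
  clearing (subst IsInteger (sym (ℚ.*-distribˡ-+ (ℕ→ℚ D) p q)) (isInteger-+ Dp Dq))

clears-scale : ∀ {D c q} → IsInteger c → D clears q → D clears (c * q)
clears-scale {D} {c} {q} c∈ℤ (clearing Dq) =
  clearing (subst IsInteger (x∙yz≈y∙xz c (ℕ→ℚ D) q) (isInteger-* c∈ℤ Dq))

clears-* : ∀ {D F p q} → D clears p → F clears q → (D ℕ.* F) clears (p * q)
clears-* {D} {F} {p} {q} (clearing Dp) (clearing Fq) = clearing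
  (subst IsInteger (trans (interchange (ℕ→ℚ D) p (ℕ→ℚ F) q) (cong (_* (p * q)) (sym (ℕ→ℚ-* D F))))
         (isInteger-* Dp Fq))

clears-∣ : ∀ {D D′ q} → D ∣ D′ → D clears q → D′ clears q
clears-∣ {D} {q = q} (divides F refl) (clearing Dq) = clearing
  (subst IsInteger (trans (sym (ℚ.*-assoc (ℕ→ℚ F) (ℕ→ℚ D) q)) (cong (_* q) (sym (ℕ→ℚ-* F D))))
         (isInteger-* (ℤ→ℚ-isInteger (+ F)) Dq))

↧-clears : ∀ q → ↧ₙ q clears q
↧-clears q = clearing (↥ q , ↧*≡↥ q)

infixr 8 _^_
_^_ : ℚ → ℕ → ℚ
q ^ zero = 1ℚ
q ^ suc k = q * q ^ k

ℤ→ℚ-^ : ∀ z k → ℤ→ℚ (z ℤ.^ k) ≡ ℤ→ℚ z ^ k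
ℤ→ℚ-^ z zero = refl
ℤ→ℚ-^ z (suc k) = trans (ℤ→ℚ-* z (z ℤ.^ k)) (cong (ℤ→ℚ z *_) (ℤ→ℚ-^ z k))

*-^-distrib : ∀ p q k → (p * q) ^ k ≡ p ^ k * q ^ k
*-^-distrib p q zero = refl
*-^-distrib p q (suc k) = trans (cong ((p * q) *_) (*-^-distrib p q k)) (interchange p q (p ^ k) (q ^ k))

abs-^ : ∀ z k → ∣ z ℤ.^ k ∣ ≡ ∣ z ∣ ℕ.^ k
abs-^ z zero = refl
abs-^ z (suc k) = trans (ℤ.abs-* z (z ℤ.^ k)) (cong (∣ z ∣ ℕ.*_) (abs-^ z k))

coprime-* : ∀ {m n o} → Coprime m n → Coprime m o → Coprime m (n ℕ.* o)
coprime-* {m} {n} m⊥n m⊥o (i∣m , i∣no) = m⊥o (i∣m , coprime-divisor i⊥n i∣no)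
  where
  i⊥n : Coprime _ n
  i⊥n (j∣i , j∣n) = m⊥n (∣-trans j∣i i∣m , j∣n)

coprime-^ʳ : ∀ {m n} → Coprime m n → ∀ k → Coprime m (n ℕ.^ k)
coprime-^ʳ {m} m⊥n zero = Coprime.sym (1-coprimeTo m)
coprime-^ʳ m⊥n (suc k) = coprime-* m⊥n (coprime-^ʳ m⊥n k)

n<m^n : ∀ {m} n → 2 ℕ.≤ m → n ℕ.< m ℕ.^ n
n<m^n zero 2≤m = ℕ.s≤s ℕ.z≤n
n<m^n {m@(suc _)} (suc n) 2≤m = begin-strict
  suc n                 ≤⟨ n<m^n n 2≤m ⟩
  m ℕ.^ n               <⟨ ℕ.m<m+n (m ℕ.^ n) (ℕ.m^n>0 m n) ⟩
  m ℕ.^ n ℕ.+ m ℕ.^ n   ≡⟨ cong (m ℕ.^ n ℕ.+_) (ℕ.+-identityʳ (m ℕ.^ n)) ⟨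
  2 ℕ.* m ℕ.^ n         ≤⟨ ℕ.*-monoˡ-≤ (m ℕ.^ n) 2≤m ⟩
  m ℕ.^ suc n           ∎
  where open ℕ.≤-Reasoning

-- If q = r/s in lowest terms with s ≥ 2, then sᴱ ∣ E·rᴱ and sᴱ is coprime to rᴱ, so sᴱ ∣ E;
-- but E < 2ᴱ ≤ sᴱ.
clears-powers⇒isInteger : ∀ E .{{_ : ℕ.NonZero E}} q → (∀ k → E clears q ^ k) → IsInteger q
clears-powers⇒isInteger E (mkℚ r zero _) _ = r , sym (ℤ→ℚ≡mkℚ r)
clears-powers⇒isInteger E q@(mkℚ r (suc d) r⊥s) E-clears = contradiction (∣⇒≤ s^E∣E) (ℕ.<⇒≱ E<s^E)
  where
  s = suc (suc d)
  z = proj₁ (_clears_.integral (E-clears E))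
  open ≡-Reasoning
  in-ℤ : + E ℤ.* r ℤ.^ E ≡ (+ s) ℤ.^ E ℤ.* z
  in-ℤ = ℤ→ℚ-injective (begin
    ℤ→ℚ (+ E ℤ.* r ℤ.^ E)         ≡⟨ trans (ℤ→ℚ-* (+ E) (r ℤ.^ E))
                                           (cong (ℕ→ℚ E *_) (ℤ→ℚ-^ r E)) ⟩
    ℕ→ℚ E * ℤ→ℚ r ^ E             ≡⟨ cong (λ t → ℕ→ℚ E * t ^ E) (↧*≡↥ q) ⟨
    ℕ→ℚ E * (ℕ→ℚ s * q) ^ E       ≡⟨ cong (ℕ→ℚ E *_) (*-^-distrib (ℕ→ℚ s) q E) ⟩
    ℕ→ℚ E * (ℕ→ℚ s ^ E * q ^ E)   ≡⟨ x∙yz≈y∙xz (ℕ→ℚ E) (ℕ→ℚ s ^ E) (q ^ E) ⟩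
    ℕ→ℚ s ^ E * (ℕ→ℚ E * q ^ E)   ≡⟨ cong (ℕ→ℚ s ^ E *_) (proj₂ (_clears_.integral (E-clears E))) ⟩
    ℕ→ℚ s ^ E * ℤ→ℚ z             ≡⟨ trans (ℤ→ℚ-* ((+ s) ℤ.^ E) z)
                                           (cong (_* ℤ→ℚ z) (ℤ→ℚ-^ (+ s) E)) ⟨
    ℤ→ℚ ((+ s) ℤ.^ E ℤ.* z)       ∎)
  in-ℕ : E ℕ.* ∣ r ∣ ℕ.^ E ≡ s ℕ.^ E ℕ.* ∣ z ∣
  in-ℕ = begin
    E ℕ.* ∣ r ∣ ℕ.^ E          ≡⟨ trans (ℤ.abs-* (+ E) (r ℤ.^ E)) (cong (E ℕ.*_) (abs-^ r E)) ⟨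
    ∣ + E ℤ.* r ℤ.^ E ∣        ≡⟨ cong ∣_∣ in-ℤ ⟩
    ∣ (+ s) ℤ.^ E ℤ.* z ∣      ≡⟨ trans (ℤ.abs-* ((+ s) ℤ.^ E) z) (cong (ℕ._* ∣ z ∣) (abs-^ (+ s) E)) ⟩
    s ℕ.^ E ℕ.* ∣ z ∣          ∎
  s^E∣E : s ℕ.^ E ∣ E
  s^E∣E = coprime-divisor (coprime-^ʳ (Coprime.sym (coprime-^ʳ (recompute r⊥s) E)) E)
            (divides ∣ z ∣ (trans (ℕ.*-comm (∣ r ∣ ℕ.^ E) E) (trans in-ℕ (ℕ.*-comm (s ℕ.^ E) ∣ z ∣))))
  E<s^E : E ℕ.< s ℕ.^ E
  E<s^E = n<m^n E (ℕ.s≤s (ℕ.s≤s ℕ.z≤n))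

*-cancelˡ-≡ : ∀ p .{{_ : NonZero p}} {q r} → p * q ≡ p * r → q ≡ r
*-cancelˡ-≡ p {q} {r} eq = begin
  q                 ≡⟨ unfold q ⟩
  1/ p * (p * q)    ≡⟨ cong (1/ p *_) eq ⟩
  1/ p * (p * r)    ≡⟨ unfold r ⟨
  r                 ∎
  where
  open ≡-Reasoning
  unfold : ∀ s → s ≡ 1/ p * (p * s)
  unfold s = trans (sym (ℚ.*-identityˡ s))
               (trans (cong (_* s) (sym (ℚ.*-inverseˡ p))) (ℚ.*-assoc (1/ p) p s))

p*q≡0⇒q≡0 : ∀ p .{{_ : NonZero p}} q → p * q ≡ 0ℚ → q ≡ 0ℚ
p*q≡0⇒q≡0 p q eq = *-cancelˡ-≡ p (trans eq (sym (ℚ.*-zeroʳ p)))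

p*p≡0⇒p≡0 : ∀ p → p * p ≡ 0ℚ → p ≡ 0ℚ
p*p≡0⇒p≡0 p eq with p ℚ.≟ 0ℚ
... | yes p≡0 = p≡0
... | no p≢0 = p*q≡0⇒q≡0 p {{≢-nonZero p≢0}} p eq

0≤p*p : ∀ p → 0ℚ ≤ p * p
0≤p*p p with ℚ.≤-total 0ℚ p
... | inj₁ 0≤p = ℚ.nonNegative⁻¹ _ {{ℚ.nonNeg*nonNeg⇒nonNeg p {{nonNegative 0≤p}} p {{nonNegative 0≤p}}}}
... | inj₂ p≤0 = ℚ.nonNegative⁻¹ _ {{ℚ.nonPos*nonPos⇒nonPos p {{nonPositive p≤0}} p {{nonPositive p≤0}}}}

p+q≡0⇒p≡0∧q≡0 : ∀ {p q} → 0ℚ ≤ p → 0ℚ ≤ q → p + q ≡ 0ℚ → p ≡ 0ℚ × q ≡ 0ℚ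
p+q≡0⇒p≡0∧q≡0 {p} {q} 0≤p 0≤q p+q≡0 =
  p≡0 , trans (sym (ℚ.+-identityˡ q)) (trans (cong (_+ q) (sym p≡0)) p+q≡0)
  where
  p≤0 : p ≤ 0ℚ
  p≤0 = subst (p ≤_) p+q≡0 (subst (_≤ p + q) (ℚ.+-identityʳ p) (ℚ.+-monoʳ-≤ p 0≤q))
  p≡0 : p ≡ 0ℚ
  p≡0 = ℚ.≤-antisym p≤0 0≤p

-- Quaternion arithmetic

sc : ℚ → Quat
sc q = quat q 0ℚ 0ℚ 0ℚ

quat-≡ : ∀ {p q} → x₀ p ≡ x₀ q → x₁ p ≡ x₁ q → x₂ p ≡ x₂ q → x₃ p ≡ x₃ q → p ≡ q
quat-≡ {quat _ _ _ _} {quat _ _ _ _} refl refl refl refl = refl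

module QuaternionSolver where
  open +-*-Solver using (Polynomial; var; prove; ⟦_⟧; ⟦_⟧↓)
  open import Data.Vec using (allFin; map)
  open import Data.Vec.N-ary using (N-ary; _$ⁿ_; curryⁿ; Eq; Eqʰ; curryⁿ-cong; curryⁿ-cong⁻¹; Eqʰ-to-Eq)

  record Quatᴾ (n : ℕ) : Set where
    constructor quatᴾ
    field c₀ c₁ c₂ c₃ : Polynomial n
  open Quatᴾ

  -- Each operation mirrors the QuatAlg operation of the same name, so that evaluating a
  -- quaternion of polynomials reproduces the expressions of Defs definitionally.
  module Ops {n} (α β : Polynomial n) where
    0ᴾ 1ᴾ : Quatᴾ n
    0ᴾ = quatᴾ (con 0ℚ) (con 0ℚ) (con 0ℚ) (con 0ℚ)
    1ᴾ = quatᴾ (con 1ℚ) (con 0ℚ) (con 0ℚ) (con 0ℚ)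

    scᴾ : Polynomial n → Quatᴾ n
    scᴾ q = quatᴾ q (con 0ℚ) (con 0ℚ) (con 0ℚ)

    _⊕ᴾ_ : Quatᴾ n → Quatᴾ n → Quatᴾ n
    quatᴾ x0 x1 x2 x3 ⊕ᴾ quatᴾ y0 y1 y2 y3 = quatᴾ (x0 :+ y0) (x1 :+ y1) (x2 :+ y2) (x3 :+ y3)

    ⊖ᴾ_ : Quatᴾ n → Quatᴾ n
    ⊖ᴾ quatᴾ x0 x1 x2 x3 = quatᴾ (:- x0) (:- x1) (:- x2) (:- x3)

    _·ᴾ_ : Polynomial n → Quatᴾ n → Quatᴾ n
    q ·ᴾ quatᴾ x0 x1 x2 x3 = quatᴾ (q :* x0) (q :* x1) (q :* x2) (q :* x3)

    _⊗ᴾ_ : Quatᴾ n → Quatᴾ n → Quatᴾ n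
    quatᴾ x0 x1 x2 x3 ⊗ᴾ quatᴾ y0 y1 y2 y3 = quatᴾ
      (x0 :* y0 :- α :* (x1 :* y1) :- β :* (x2 :* y2) :- (α :* β) :* (x3 :* y3))
      (x0 :* y1 :+ x1 :* y0 :+ β :* (x2 :* y3 :- x3 :* y2))
      (x0 :* y2 :+ x2 :* y0 :+ α :* (x3 :* y1 :- x1 :* y3))
      (x0 :* y3 :+ x3 :* y0 :+ x1 :* y2 :- x2 :* y1)

    conjᴾ : Quatᴾ n → Quatᴾ n
    conjᴾ (quatᴾ x0 x1 x2 x3) = quatᴾ x0 (:- x1) (:- x2) (:- x3)

    Nᴾ : Quatᴾ n → Polynomial n
    Nᴾ (quatᴾ x0 x1 x2 x3) = x0 :* x0 :+ α :* (x1 :* x1) :+ β :* (x2 :* x2) :+ (α :* β) :* (x3 :* x3)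

  private
    variable n : ℕ

    ⟦_⟧ᴴ ⟦_⟧↓ᴴ : Quatᴾ n → Vec ℚ n → Quat
    ⟦ quatᴾ p0 p1 p2 p3 ⟧ᴴ ρ = quat (⟦ p0 ⟧ ρ) (⟦ p1 ⟧ ρ) (⟦ p2 ⟧ ρ) (⟦ p3 ⟧ ρ)
    ⟦ quatᴾ p0 p1 p2 p3 ⟧↓ᴴ ρ = quat (⟦ p0 ⟧↓ ρ) (⟦ p1 ⟧↓ ρ) (⟦ p2 ⟧↓ ρ) (⟦ p3 ⟧↓ ρ)

    close : ∀ {A : Set} n → N-ary n (Polynomial n) A → A
    close n f = f $ⁿ map var (allFin n)

  quat-solve : ∀ n (f : N-ary n (Polynomial n) (Quatᴾ n × Quatᴾ n)) →
    Eqʰ n _≡_ (curryⁿ ⟦ proj₁ (close n f) ⟧↓ᴴ) (curryⁿ ⟦ proj₂ (close n f) ⟧↓ᴴ) →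
    Eq n _≡_ (curryⁿ ⟦ proj₁ (close n f) ⟧ᴴ) (curryⁿ ⟦ proj₂ (close n f) ⟧ᴴ)
  quat-solve n f hyp = curryⁿ-cong _≡_ ⟦ P ⟧ᴴ ⟦ Q ⟧ᴴ λ ρ → quat-≡
    (prove ρ (c₀ P) (c₀ Q) (cong x₀ (normal ρ))) (prove ρ (c₁ P) (c₁ Q) (cong x₁ (normal ρ)))
    (prove ρ (c₂ P) (c₂ Q) (cong x₂ (normal ρ))) (prove ρ (c₃ P) (c₃ Q) (cong x₃ (normal ρ)))
    where
    P = proj₁ (close n f)
    Q = proj₂ (close n f)
    normal = curryⁿ-cong⁻¹ _≡_ ⟦ P ⟧↓ᴴ ⟦ Q ⟧↓ᴴ (Eqʰ-to-Eq n _≡_ hyp)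

open QuaternionSolver using (quatᴾ; module Ops; quat-solve)

module QuaternionLaws (a b : ℚ) where
  open QuatAlg a b

  ⊗-assoc : ∀ x y z → (x ⊗ y) ⊗ z ≡ x ⊗ (y ⊗ z)
  ⊗-assoc (quat x0 x1 x2 x3) (quat y0 y1 y2 y3) (quat z0 z1 z2 z3) =
    quat-solve 14 (λ α β x0 x1 x2 x3 y0 y1 y2 y3 z0 z1 z2 z3 →
      let open Ops α β
          X = quatᴾ x0 x1 x2 x3; Y = quatᴾ y0 y1 y2 y3; Z = quatᴾ z0 z1 z2 z3
      in (X ⊗ᴾ Y) ⊗ᴾ Z , X ⊗ᴾ (Y ⊗ᴾ Z))
      refl a b x0 x1 x2 x3 y0 y1 y2 y3 z0 z1 z2 z3

  ⊗-distribˡ : ∀ x y z → x ⊗ (y ⊕ z) ≡ (x ⊗ y) ⊕ (x ⊗ z)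
  ⊗-distribˡ (quat x0 x1 x2 x3) (quat y0 y1 y2 y3) (quat z0 z1 z2 z3) =
    quat-solve 14 (λ α β x0 x1 x2 x3 y0 y1 y2 y3 z0 z1 z2 z3 →
      let open Ops α β
          X = quatᴾ x0 x1 x2 x3; Y = quatᴾ y0 y1 y2 y3; Z = quatᴾ z0 z1 z2 z3
      in X ⊗ᴾ (Y ⊕ᴾ Z) , (X ⊗ᴾ Y) ⊕ᴾ (X ⊗ᴾ Z))
      refl a b x0 x1 x2 x3 y0 y1 y2 y3 z0 z1 z2 z3

  ⊗-distribʳ : ∀ x y z → (x ⊕ y) ⊗ z ≡ (x ⊗ z) ⊕ (y ⊗ z)
  ⊗-distribʳ (quat x0 x1 x2 x3) (quat y0 y1 y2 y3) (quat z0 z1 z2 z3) =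
    quat-solve 14 (λ α β x0 x1 x2 x3 y0 y1 y2 y3 z0 z1 z2 z3 →
      let open Ops α β
          X = quatᴾ x0 x1 x2 x3; Y = quatᴾ y0 y1 y2 y3; Z = quatᴾ z0 z1 z2 z3
      in (X ⊕ᴾ Y) ⊗ᴾ Z , (X ⊗ᴾ Z) ⊕ᴾ (Y ⊗ᴾ Z))
      refl a b x0 x1 x2 x3 y0 y1 y2 y3 z0 z1 z2 z3

  ⊗-identityˡ : ∀ x → 1H ⊗ x ≡ x
  ⊗-identityˡ (quat x0 x1 x2 x3) =
    quat-solve 6 (λ α β x0 x1 x2 x3 → let open Ops α β; X = quatᴾ x0 x1 x2 x3 in 1ᴾ ⊗ᴾ X , X)
      refl a b x0 x1 x2 x3

  ⊗-identityʳ : ∀ x → x ⊗ 1H ≡ x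
  ⊗-identityʳ (quat x0 x1 x2 x3) =
    quat-solve 6 (λ α β x0 x1 x2 x3 → let open Ops α β; X = quatᴾ x0 x1 x2 x3 in X ⊗ᴾ 1ᴾ , X)
      refl a b x0 x1 x2 x3

  ⊗-zeroˡ : ∀ x → 0H ⊗ x ≡ 0H
  ⊗-zeroˡ (quat x0 x1 x2 x3) =
    quat-solve 6 (λ α β x0 x1 x2 x3 → let open Ops α β; X = quatᴾ x0 x1 x2 x3 in 0ᴾ ⊗ᴾ X , 0ᴾ)
      refl a b x0 x1 x2 x3

  ⊕-identityˡ : ∀ x → 0H ⊕ x ≡ x
  ⊕-identityˡ (quat x0 x1 x2 x3) =
    quat-solve 6 (λ α β x0 x1 x2 x3 → let open Ops α β; X = quatᴾ x0 x1 x2 x3 in 0ᴾ ⊕ᴾ X , X)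
      refl a b x0 x1 x2 x3

  ⊕-identityʳ : ∀ x → x ⊕ 0H ≡ x
  ⊕-identityʳ (quat x0 x1 x2 x3) =
    quat-solve 6 (λ α β x0 x1 x2 x3 → let open Ops α β; X = quatᴾ x0 x1 x2 x3 in X ⊕ᴾ 0ᴾ , X)
      refl a b x0 x1 x2 x3

  ⊕-interchange : ∀ w x y z → (w ⊕ x) ⊕ (y ⊕ z) ≡ (w ⊕ y) ⊕ (x ⊕ z)
  ⊕-interchange (quat w0 w1 w2 w3) (quat x0 x1 x2 x3) (quat y0 y1 y2 y3) (quat z0 z1 z2 z3) =
    quat-solve 18 (λ α β w0 w1 w2 w3 x0 x1 x2 x3 y0 y1 y2 y3 z0 z1 z2 z3 →
      let open Ops α β
          W = quatᴾ w0 w1 w2 w3; X = quatᴾ x0 x1 x2 x3; Y = quatᴾ y0 y1 y2 y3; Z = quatᴾ z0 z1 z2 z3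
      in (W ⊕ᴾ X) ⊕ᴾ (Y ⊕ᴾ Z) , (W ⊕ᴾ Y) ⊕ᴾ (X ⊕ᴾ Z))
      refl a b w0 w1 w2 w3 x0 x1 x2 x3 y0 y1 y2 y3 z0 z1 z2 z3

  ⊖-⊕ : ∀ x y → ⊖ (x ⊕ y) ≡ (⊖ x) ⊕ (⊖ y)
  ⊖-⊕ (quat x0 x1 x2 x3) (quat y0 y1 y2 y3) =
    quat-solve 10 (λ α β x0 x1 x2 x3 y0 y1 y2 y3 →
      let open Ops α β
          X = quatᴾ x0 x1 x2 x3; Y = quatᴾ y0 y1 y2 y3
      in ⊖ᴾ (X ⊕ᴾ Y) , (⊖ᴾ X) ⊕ᴾ (⊖ᴾ Y))
      refl a b x0 x1 x2 x3 y0 y1 y2 y3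

  ⊖-⊗ : ∀ x y → (⊖ x) ⊗ y ≡ ⊖ (x ⊗ y)
  ⊖-⊗ (quat x0 x1 x2 x3) (quat y0 y1 y2 y3) =
    quat-solve 10 (λ α β x0 x1 x2 x3 y0 y1 y2 y3 →
      let open Ops α β
          X = quatᴾ x0 x1 x2 x3; Y = quatᴾ y0 y1 y2 y3
      in (⊖ᴾ X) ⊗ᴾ Y , ⊖ᴾ (X ⊗ᴾ Y))
      refl a b x0 x1 x2 x3 y0 y1 y2 y3

  sc-⊗ : ∀ q x → sc q ⊗ x ≡ q · x
  sc-⊗ q (quat x0 x1 x2 x3) =
    quat-solve 7 (λ α β q x0 x1 x2 x3 → let open Ops α β; X = quatᴾ x0 x1 x2 x3 in scᴾ q ⊗ᴾ X , q ·ᴾ X)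
      refl a b q x0 x1 x2 x3

  ⊗-sc : ∀ x q → x ⊗ sc q ≡ q · x
  ⊗-sc (quat x0 x1 x2 x3) q =
    quat-solve 7 (λ α β q x0 x1 x2 x3 → let open Ops α β; X = quatᴾ x0 x1 x2 x3 in X ⊗ᴾ scᴾ q , q ·ᴾ X)
      refl a b q x0 x1 x2 x3

  ·-⊗ : ∀ q x y → (q · x) ⊗ y ≡ q · (x ⊗ y)
  ·-⊗ q (quat x0 x1 x2 x3) (quat y0 y1 y2 y3) =
    quat-solve 11 (λ α β q x0 x1 x2 x3 y0 y1 y2 y3 →
      let open Ops α β
          X = quatᴾ x0 x1 x2 x3; Y = quatᴾ y0 y1 y2 y3
      in (q ·ᴾ X) ⊗ᴾ Y , q ·ᴾ (X ⊗ᴾ Y))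
      refl a b q x0 x1 x2 x3 y0 y1 y2 y3

  ⊗-· : ∀ q x y → x ⊗ (q · y) ≡ q · (x ⊗ y)
  ⊗-· q (quat x0 x1 x2 x3) (quat y0 y1 y2 y3) =
    quat-solve 11 (λ α β q x0 x1 x2 x3 y0 y1 y2 y3 →
      let open Ops α β
          X = quatᴾ x0 x1 x2 x3; Y = quatᴾ y0 y1 y2 y3
      in X ⊗ᴾ (q ·ᴾ Y) , q ·ᴾ (X ⊗ᴾ Y))
      refl a b q x0 x1 x2 x3 y0 y1 y2 y3

  sc-+ : ∀ p q → sc (p + q) ≡ sc p ⊕ sc q
  sc-+ p q = quat-solve 4 (λ α β p q → let open Ops α β in scᴾ (p :+ q) , scᴾ p ⊕ᴾ scᴾ q) refl a b p q

  sc-neg : ∀ q → sc (- q) ≡ ⊖ sc q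
  sc-neg q = quat-solve 3 (λ α β q → let open Ops α β in scᴾ (:- q) , ⊖ᴾ scᴾ q) refl a b q

  sc-⊗-⊗-sc : ∀ p y q → sc p ⊗ (y ⊗ sc q) ≡ y ⊗ sc (q * p)
  sc-⊗-⊗-sc p (quat y0 y1 y2 y3) q =
    quat-solve 8 (λ α β p y0 y1 y2 y3 q → let open Ops α β; Y = quatᴾ y0 y1 y2 y3
                  in scᴾ p ⊗ᴾ (Y ⊗ᴾ scᴾ q) , Y ⊗ᴾ scᴾ (q :* p))
      refl a b p y0 y1 y2 y3 q

  conj-⊗ : ∀ x y → conj (x ⊗ y) ≡ conj y ⊗ conj x
  conj-⊗ (quat x0 x1 x2 x3) (quat y0 y1 y2 y3) =
    quat-solve 10 (λ α β x0 x1 x2 x3 y0 y1 y2 y3 →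
      let open Ops α β
          X = quatᴾ x0 x1 x2 x3; Y = quatᴾ y0 y1 y2 y3
      in conjᴾ (X ⊗ᴾ Y) , conjᴾ Y ⊗ᴾ conjᴾ X)
      refl a b x0 x1 x2 x3 y0 y1 y2 y3

  conj-involutive : ∀ x → conj (conj x) ≡ x
  conj-involutive (quat x0 x1 x2 x3) =
    quat-solve 6 (λ α β x0 x1 x2 x3 → let open Ops α β; X = quatᴾ x0 x1 x2 x3 in conjᴾ (conjᴾ X) , X)
      refl a b x0 x1 x2 x3

  conj-⊕ : ∀ x y → conj (x ⊕ y) ≡ conj x ⊕ conj y
  conj-⊕ (quat x0 x1 x2 x3) (quat y0 y1 y2 y3) =
    quat-solve 10 (λ α β x0 x1 x2 x3 y0 y1 y2 y3 →
      let open Ops α β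
          X = quatᴾ x0 x1 x2 x3; Y = quatᴾ y0 y1 y2 y3
      in conjᴾ (X ⊕ᴾ Y) , conjᴾ X ⊕ᴾ conjᴾ Y)
      refl a b x0 x1 x2 x3 y0 y1 y2 y3

  conj-⊖ : ∀ x → conj (⊖ x) ≡ ⊖ conj x
  conj-⊖ (quat x0 x1 x2 x3) =
    quat-solve 6 (λ α β x0 x1 x2 x3 → let open Ops α β; X = quatᴾ x0 x1 x2 x3 in conjᴾ (⊖ᴾ X) , ⊖ᴾ conjᴾ X)
      refl a b x0 x1 x2 x3

  conj-· : ∀ q x → conj (q · x) ≡ q · conj x
  conj-· q (quat x0 x1 x2 x3) =
    quat-solve 7 (λ α β q x0 x1 x2 x3 → let open Ops α β; X = quatᴾ x0 x1 x2 x3 in conjᴾ (q ·ᴾ X) , q ·ᴾ conjᴾ X)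
      refl a b q x0 x1 x2 x3

  conj-sc : ∀ q → conj (sc q) ≡ sc q
  conj-sc q = quat-solve 3 (λ α β q → let open Ops α β in conjᴾ (scᴾ q) , scᴾ q) refl a b q

  conj≡trace-x : ∀ x → conj x ≡ sc (x₀ x + x₀ x) ⊕ (⊖ x)
  conj≡trace-x (quat x0 x1 x2 x3) =
    quat-solve 6 (λ α β x0 x1 x2 x3 → let open Ops α β; X = quatᴾ x0 x1 x2 x3
                  in conjᴾ X , scᴾ (x0 :+ x0) ⊕ᴾ (⊖ᴾ X))
      refl a b x0 x1 x2 x3

  ⊗-conjʳ : ∀ x → x ⊗ conj x ≡ sc (N x)
  ⊗-conjʳ (quat x0 x1 x2 x3) =
    quat-solve 6 (λ α β x0 x1 x2 x3 → let open Ops α β; X = quatᴾ x0 x1 x2 x3 in X ⊗ᴾ conjᴾ X , scᴾ (Nᴾ X))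
      refl a b x0 x1 x2 x3

  ⊗-conjˡ : ∀ x → conj x ⊗ x ≡ sc (N x)
  ⊗-conjˡ (quat x0 x1 x2 x3) =
    quat-solve 6 (λ α β x0 x1 x2 x3 → let open Ops α β; X = quatᴾ x0 x1 x2 x3 in conjᴾ X ⊗ᴾ X , scᴾ (Nᴾ X))
      refl a b x0 x1 x2 x3

  N-⊗ : ∀ x y → N (x ⊗ y) ≡ N x * N y
  N-⊗ (quat x0 x1 x2 x3) (quat y0 y1 y2 y3) =
    solve 10 (λ α β x0 x1 x2 x3 y0 y1 y2 y3 →
      let open Ops α β
          X = quatᴾ x0 x1 x2 x3; Y = quatᴾ y0 y1 y2 y3
      in Nᴾ (X ⊗ᴾ Y) := Nᴾ X :* Nᴾ Y)
      refl a b x0 x1 x2 x3 y0 y1 y2 y3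

  N-conj : ∀ x → N (conj x) ≡ N x
  N-conj (quat x0 x1 x2 x3) =
    solve 6 (λ α β x0 x1 x2 x3 → let open Ops α β; X = quatᴾ x0 x1 x2 x3 in Nᴾ (conjᴾ X) := Nᴾ X)
      refl a b x0 x1 x2 x3

  N-sc : ∀ q → N (sc q) ≡ q * q
  N-sc q = solve 3 (λ α β q → let open Ops α β in Nᴾ (scᴾ q) := q :* q) refl a b q

  N-⊕1H : ∀ x → N (x ⊕ 1H) ≡ N x + (x₀ x + x₀ x) + 1ℚ
  N-⊕1H (quat x0 x1 x2 x3) =
    solve 6 (λ α β x0 x1 x2 x3 → let open Ops α β; X = quatᴾ x0 x1 x2 x3
             in Nᴾ (X ⊕ᴾ 1ᴾ) := Nᴾ X :+ (x0 :+ x0) :+ con 1ℚ)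
      refl a b x0 x1 x2 x3

  infixr 8 _⊗^_
  _⊗^_ : Quat → ℕ → Quat
  x ⊗^ zero = 1H
  x ⊗^ suc k = x ⊗ (x ⊗^ k)

  N-⊗^ : ∀ x k → N (x ⊗^ k) ≡ N x ^ k
  N-⊗^ x zero = N-sc 1ℚ
  N-⊗^ x (suc k) = trans (N-⊗ x (x ⊗^ k)) (cong (N x *_) (N-⊗^ x k))

module PositiveDefinite (a b : ℚ) .{{_ : Positive a}} .{{_ : Positive b}} where
  open QuatAlg a b

  private
    instance
      ab>0 : Positive (a * b)
      ab>0 = ℚ.pos*pos⇒pos a b
      a≢0 : NonZero a
      a≢0 = ℚ.pos⇒nonZero a
      b≢0 : NonZero b
      b≢0 = ℚ.pos⇒nonZero b
      ab≢0 : NonZero (a * b)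
      ab≢0 = ℚ.pos⇒nonZero (a * b)

    0≤c*p*p : ∀ c .{{_ : Positive c}} p → 0ℚ ≤ c * (p * p)
    0≤c*p*p c p = ℚ.nonNegative⁻¹ _
      {{ℚ.nonNeg*nonNeg⇒nonNeg c {{ℚ.pos⇒nonNeg c}} (p * p) {{nonNegative (0≤p*p p)}}}}

  0≤N : ∀ x → 0ℚ ≤ N x
  0≤N (quat x0 x1 x2 x3) =
    ℚ.+-mono-≤ (ℚ.+-mono-≤ (ℚ.+-mono-≤ (0≤p*p x0) (0≤c*p*p a x1)) (0≤c*p*p b x2)) (0≤c*p*p (a * b) x3)

  N≡0⇒≡0H : ∀ x → N x ≡ 0ℚ → x ≡ 0H
  N≡0⇒≡0H (quat x0 x1 x2 x3) N≡0 = quat-≡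
    (p*p≡0⇒p≡0 x0 (proj₁ split₀₁))
    (p*p≡0⇒p≡0 x1 (p*q≡0⇒q≡0 a _ (proj₂ split₀₁)))
    (p*p≡0⇒p≡0 x2 (p*q≡0⇒q≡0 b _ (proj₂ split₀₁₂)))
    (p*p≡0⇒p≡0 x3 (p*q≡0⇒q≡0 (a * b) _ (proj₂ split)))
    where
    t₀ = 0≤p*p x0
    t₁ = 0≤c*p*p a x1
    t₂ = 0≤c*p*p b x2
    t₃ = 0≤c*p*p (a * b) x3
    split = p+q≡0⇒p≡0∧q≡0 (ℚ.+-mono-≤ (ℚ.+-mono-≤ t₀ t₁) t₂) t₃ N≡0
    split₀₁₂ = p+q≡0⇒p≡0∧q≡0 (ℚ.+-mono-≤ t₀ t₁) t₂ (proj₁ split)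
    split₀₁ = p+q≡0⇒p≡0∧q≡0 t₀ t₁ (proj₁ split₀₁₂)

-- Bounded denominators

infix 4 _clearsᴴ_
_clearsᴴ_ : ℕ → Quat → Set
D clearsᴴ x = D clears x₀ x × D clears x₁ x × D clears x₂ x × D clears x₃ x

module QuaternionDenominators (a b : ℚ) where
  open QuatAlg a b

  clearsᴴ-0H : ∀ {D} → D clearsᴴ 0H
  clearsᴴ-0H {D} = zero′ , zero′ , zero′ , zero′
    where
    zero′ : D clears 0ℚ
    zero′ = clearing (+ 0 , ℚ.*-zeroʳ (ℕ→ℚ D))

  clearsᴴ-⊕ : ∀ {D x y} → D clearsᴴ x → D clearsᴴ y → D clearsᴴ (x ⊕ y)
  clearsᴴ-⊕ (x0 , x1 , x2 , x3) (y0 , y1 , y2 , y3) =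
    clears-+ x0 y0 , clears-+ x1 y1 , clears-+ x2 y2 , clears-+ x3 y3

  clearsᴴ-scale : ∀ {D x} c → D clearsᴴ x → D clearsᴴ (ℤ→ℚ c · x)
  clearsᴴ-scale c (x0 , x1 , x2 , x3) =
    clears-scale c∈ℤ x0 , clears-scale c∈ℤ x1 , clears-scale c∈ℤ x2 , clears-scale c∈ℤ x3
    where c∈ℤ = ℤ→ℚ-isInteger c

  clearsᴴ-∣ : ∀ {D D′ x} → D ∣ D′ → D clearsᴴ x → D′ clearsᴴ x
  clearsᴴ-∣ D∣D′ (x0 , x1 , x2 , x3) =
    clears-∣ D∣D′ x0 , clears-∣ D∣D′ x1 , clears-∣ D∣D′ x2 , clears-∣ D∣D′ x3

  denominator : Quat → ℕ
  denominator x = ↧ₙ x₀ x ℕ.* (↧ₙ x₁ x ℕ.* (↧ₙ x₂ x ℕ.* ↧ₙ x₃ x))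

  denominator-clearsᴴ : ∀ x → denominator x clearsᴴ x
  denominator-clearsᴴ x =
    clears-∣ (m∣m*n {d₀} (d₁ ℕ.* (d₂ ℕ.* d₃))) (↧-clears (x₀ x)) ,
    clears-∣ (∣-trans (m∣m*n {d₁} (d₂ ℕ.* d₃)) (n∣m*n d₀)) (↧-clears (x₁ x)) ,
    clears-∣ (∣-trans (m∣m*n {d₂} d₃) (∣-trans (n∣m*n d₁) (n∣m*n d₀))) (↧-clears (x₂ x)) ,
    clears-∣ (∣-trans (n∣m*n d₂ {d₃}) (∣-trans (n∣m*n d₁) (n∣m*n d₀))) (↧-clears (x₃ x))
    where
    d₀ = ↧ₙ x₀ x
    d₁ = ↧ₙ x₁ x
    d₂ = ↧ₙ x₂ x
    d₃ = ↧ₙ x₃ x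

  commonDenominator : ∀ {n} → Vec Quat n → ℕ
  commonDenominator [] = 1
  commonDenominator (g ∷ gs) = denominator g ℕ.* commonDenominator gs

  commonDenominator-nonZero : ∀ {n} (gs : Vec Quat n) → ℕ.NonZero (commonDenominator gs)
  commonDenominator-nonZero [] = _
  commonDenominator-nonZero (g ∷ gs) = ℕ.m*n≢0 (denominator g) (commonDenominator gs)
    where instance _ = commonDenominator-nonZero gs

  combination-clearsᴴ : ∀ {n} (cs : Vec ℤ n) gs →
    commonDenominator gs clearsᴴ Σq (zipWith (λ c g → ℤ→ℚ c · g) cs gs)
  combination-clearsᴴ [] [] = clearsᴴ-0H
  combination-clearsᴴ (c ∷ cs) (g ∷ gs) =
    clearsᴴ-⊕ (clearsᴴ-∣ (m∣m*n {denominator g} (commonDenominator gs)) (clearsᴴ-scale c (denominator-clearsᴴ g)))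
              (clearsᴴ-∣ (n∣m*n (denominator g)) (combination-clearsᴴ cs gs))

  normDenominator : ℕ → ℕ
  normDenominator D = (↧ₙ a ℕ.* ↧ₙ b) ℕ.* (D ℕ.* D)

  N-clears : ∀ {D} x → D clearsᴴ x → normDenominator D clears N x
  N-clears {D} x (x0 , x1 , x2 , x3) = clears-+ (clears-+ (clears-+ t0 t1) t2) t3
    where
    A = ↧ₙ a
    B = ↧ₙ b
    t0 : normDenominator D clears (x₀ x * x₀ x)
    t0 = clears-∣ (n∣m*n (A ℕ.* B)) (clears-* x0 x0)
    t1 : normDenominator D clears (a * (x₁ x * x₁ x))
    t1 = clears-∣ (*-monoˡ-∣ (D ℕ.* D) (m∣m*n {A} B)) (clears-* (↧-clears a) (clears-* x1 x1))
    t2 : normDenominator D clears (b * (x₂ x * x₂ x))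
    t2 = clears-∣ (*-monoˡ-∣ (D ℕ.* D) (n∣m*n A {B})) (clears-* (↧-clears b) (clears-* x2 x2))
    t3 : normDenominator D clears ((a * b) * (x₃ x * x₃ x))
    t3 = clears-* (clears-* (↧-clears a) (↧-clears b)) (clears-* x3 x3)

-- Orders

module Order (a b : ℚ) {H : Quat → Set} (order : QuatAlg.IsOrder a b H) where
  open QuatAlg a b
  open IsOrder order
  open QuaternionLaws a b
  open QuaternionDenominators a b

  sc-ℕ-∈ : ∀ n → H (sc (ℕ→ℚ n))
  sc-ℕ-∈ zero = zero∈
  sc-ℕ-∈ (suc n) =
    subst H (sym (trans (cong sc (ℤ→ℚ-+ (+ 1) (+ n))) (sc-+ 1ℚ (ℕ→ℚ n)))) (add∈ one∈ (sc-ℕ-∈ n))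

  sc-ℤ-∈ : ∀ z → H (sc (ℤ→ℚ z))
  sc-ℤ-∈ (+ n) = sc-ℕ-∈ n
  sc-ℤ-∈ -[1+ n ] =
    subst H (sym (trans (cong sc (ℤ→ℚ-neg (+ suc n))) (sc-neg (ℕ→ℚ (suc n))))) (neg∈ (sc-ℕ-∈ (suc n)))

  ⊗^-∈ : ∀ {x} → H x → ∀ k → H (x ⊗^ k)
  ⊗^-∈ x∈H zero = one∈
  ⊗^-∈ x∈H (suc k) = mul∈ x∈H (⊗^-∈ x∈H k)

  private
    generators = proj₁ (proj₂ fingen)
    D = commonDenominator generators
    instance
      D≢0 : ℕ.NonZero D
      D≢0 = commonDenominator-nonZero generators
      D²≢0 : ℕ.NonZero (D ℕ.* D)
      D²≢0 = ℕ.m*n≢0 D D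
      E≢0 : ℕ.NonZero (normDenominator D)
      E≢0 = ℕ.m*n≢0 (↧ₙ a ℕ.* ↧ₙ b) (D ℕ.* D)

  bounded-denominators : ∀ {x} → H x → D clearsᴴ x
  bounded-denominators x∈H with proj₂ (proj₂ (proj₂ fingen)) _ x∈H
  ... | cs , refl = combination-clearsᴴ cs generators

  N-isInteger : ∀ {x} → H x → IsInteger (N x)
  N-isInteger {x} x∈H = clears-powers⇒isInteger (normDenominator D) (N x) λ k →
    subst (normDenominator D clears_) (N-⊗^ x k) (N-clears (x ⊗^ k) (bounded-denominators (⊗^-∈ x∈H k)))

  trace-isInteger : ∀ {x} → H x → IsInteger (x₀ x + x₀ x)
  trace-isInteger {x} x∈H = subst IsInteger trace≡
    (isInteger-+ (isInteger-+ (N-isInteger (add∈ x∈H one∈)) (isInteger-neg (N-isInteger x∈H)))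
                 (isInteger-neg (ℤ→ℚ-isInteger (+ 1))))
    where
    cancel : ∀ n t → n + t + 1ℚ + - n + - 1ℚ ≡ t
    cancel = solve 2 (λ n t → n :+ t :+ con 1ℚ :+ :- n :+ :- con 1ℚ := t) refl
    trace≡ : N (x ⊕ 1H) + - N x + - 1ℚ ≡ x₀ x + x₀ x
    trace≡ = trans (cong (λ n → n + - N x + - 1ℚ) (N-⊕1H x)) (cancel (N x) (x₀ x + x₀ x))

  conj-∈ : ∀ {x} → H x → H (conj x)
  conj-∈ {x} x∈H = subst H (sym (conj≡trace-x x)) (add∈ trace∈H (neg∈ x∈H))
    where
    trace∈H : H (sc (x₀ x + x₀ x))
    trace∈H = subst H (cong sc (sym (proj₂ (trace-isInteger x∈H)))) (sc-ℤ-∈ (proj₁ (trace-isInteger x∈H)))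

factors-of-p² : ∀ {p u v} → Prime p → u ℕ.* v ≡ p ℕ.* p → v ≡ p ⊎ v ≡ 1 ⊎ u ≡ 1
factors-of-p² {p} {u} {v} p-prime uv≡pp with euclidsLemma u v p-prime (divides p uv≡pp)
... | inj₂ (divides c refl) = case prime⇒irreducible p-prime (divides u (sym uc≡p)) of λ where
      (inj₁ refl) → inj₁ (ℕ.*-identityˡ p)
      (inj₂ refl) → inj₂ (inj₂ (ℕ.*-cancelʳ-≡ u 1 p (trans uc≡p (sym (ℕ.*-identityˡ p)))))
  where
  instance _ = prime⇒nonZero p-prime
  uc≡p : u ℕ.* c ≡ p
  uc≡p = ℕ.*-cancelʳ-≡ (u ℕ.* c) p p (trans (ℕ.*-assoc u c p) uv≡pp)
... | inj₁ (divides c refl) = case prime⇒irreducible p-prime (divides c (sym cv≡p)) of λ where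
      (inj₁ v≡1) → inj₂ (inj₁ v≡1)
      (inj₂ v≡p) → inj₁ v≡p
  where
  instance _ = prime⇒nonZero p-prime
  cv≡p : c ℕ.* v ≡ p
  cv≡p = ℕ.*-cancelʳ-≡ (c ℕ.* v) p p
           (trans (trans (ℕ.*-assoc c v p) (trans (cong (c ℕ.*_) (ℕ.*-comm v p)) (sym (ℕ.*-assoc c p v)))) uv≡pp)

-- Divisors of prescribed norm

module RightDivisors (a b : ℚ) .{{_ : Positive a}} .{{_ : Positive b}} {H : Quat → Set}
                     (order : QuatAlg.IsOrder a b H) where
  open QuatAlg a b
  open IsOrder order
  open QuaternionLaws a b
  open PositiveDefinite a b
  open Order a b order

  N-natural : ∀ {x} → H x → Σ ℕ λ n → N x ≡ ℕ→ℚ n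
  N-natural {x} x∈H = natural (N-isInteger x∈H)
    where
    natural : IsInteger (N x) → Σ ℕ λ n → N x ≡ ℕ→ℚ n
    natural (+ n , N≡n) = n , N≡n
    natural (-[1+ n ] , N≡-n) =
      ⊥-elim (ℚ.nonNeg≢neg (N x) (ℤ→ℚ -[1+ n ]) {{nonNegative (0≤N x)}} {{negative}} N≡-n)
      where
      negative : Negative (ℤ→ℚ -[1+ n ])
      negative = subst Negative (sym (ℤ→ℚ≡mkℚ -[1+ n ])) _

  N≡1⇒isUnit : ∀ {u} → H u → N u ≡ 1ℚ → IsUnit H u
  N≡1⇒isUnit {u} u∈H N≡1 =
    u∈H , conj u , conj-∈ u∈H , trans (⊗-conjʳ u) (cong sc N≡1) , trans (⊗-conjˡ u) (cong sc N≡1)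

  primitive⇒N≢0 : ∀ {θ} → Primitive H θ → N θ ≢ 0ℚ
  primitive⇒N≢0 {θ} (_ , only-units) N≡0 with only-units (+ 0) 0H zero∈ (N≡0⇒≡0H θ N≡0)
  ... | inj₁ ()
  ... | inj₂ ()

  primitive⇒∣N≢0 : ∀ {θ} m → Primitive H θ → m ∣N θ → m ≢ 0
  primitive⇒∣N≢0 {θ} m prim (k , Nθ≡mk) refl = primitive⇒N≢0 {θ} prim (trans Nθ≡mk (ℚ.*-zeroˡ (ℤ→ℚ k)))

  primitive⇒≢prime-multiple : ∀ {θ p η} → Primitive H θ → Prime p → H η → θ ≢ ℕ→ℚ p · η
  primitive⇒≢prime-multiple {p = p} (_ , only-units) p-prime η∈H θ≡pη with only-units (+ p) _ η∈H θ≡pη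
  ... | inj₁ refl = ¬prime[1] p-prime
  ... | inj₂ ()

  primitive-cofactor : ∀ {θ f γ} → Primitive H θ → H f → H γ → θ ≡ f ⊗ γ → Primitive H f
  primitive-cofactor {γ = γ} (_ , only-units) f∈H γ∈H θ≡fγ = f∈H , λ n η η∈H f≡nη →
    only-units n (η ⊗ γ) (mul∈ η∈H γ∈H) (trans θ≡fγ (trans (cong (_⊗ γ) f≡nη) (·-⊗ (ℤ→ℚ n) η γ)))

  ∣N-*ʳ : ∀ m n {θ} → (m ℕ.* n) ∣N θ → m ∣N θ
  ∣N-*ʳ m n {θ} (k , Nθ≡) = + n ℤ.* k , (begin
    N θ                        ≡⟨ Nθ≡ ⟩
    ℕ→ℚ (m ℕ.* n) * ℤ→ℚ k      ≡⟨ cong (_* ℤ→ℚ k) (ℕ→ℚ-* m n) ⟩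
    ℕ→ℚ m * ℕ→ℚ n * ℤ→ℚ k      ≡⟨ ℚ.*-assoc (ℕ→ℚ m) (ℕ→ℚ n) (ℤ→ℚ k) ⟩
    ℕ→ℚ m * (ℕ→ℚ n * ℤ→ℚ k)    ≡⟨ cong (ℕ→ℚ m *_) (ℤ→ℚ-* (+ n) k) ⟨
    ℕ→ℚ m * ℤ→ℚ (+ n ℤ.* k)    ∎)
    where open ≡-Reasoning

  ∣N-cofactor : ∀ m n {θ} f γ .{{_ : ℕ.NonZero m}} →
                (m ℕ.* n) ∣N θ → θ ≡ f ⊗ γ → N γ ≡ ℕ→ℚ m → n ∣N f
  ∣N-cofactor m n {θ} f γ (k , Nθ≡) θ≡fγ Nγ≡m = k , *-cancelˡ-≡ (ℕ→ℚ m) {{ℕ→ℚ-nonZero m}} (begin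
    ℕ→ℚ m * N f                ≡⟨ ℚ.*-comm (ℕ→ℚ m) (N f) ⟩
    N f * ℕ→ℚ m                ≡⟨ cong (N f *_) Nγ≡m ⟨
    N f * N γ                  ≡⟨ N-⊗ f γ ⟨
    N (f ⊗ γ)                  ≡⟨ cong N θ≡fγ ⟨
    N θ                        ≡⟨ Nθ≡ ⟩
    ℕ→ℚ (m ℕ.* n) * ℤ→ℚ k      ≡⟨ cong (_* ℤ→ℚ k) (ℕ→ℚ-* m n) ⟩
    ℕ→ℚ m * ℕ→ℚ n * ℤ→ℚ k      ≡⟨ ℚ.*-assoc (ℕ→ℚ m) (ℕ→ℚ n) (ℤ→ℚ k) ⟩
    ℕ→ℚ m * (ℕ→ℚ n * ℤ→ℚ k)    ∎)
    where open ≡-Reasoning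

  record LeftSpan (θ : Quat) (m : ℕ) (x : Quat) : Set where
    constructor span
    field
      h k : Quat
      h∈H : H h
      k∈H : H k
      x≡hθ+km : x ≡ (h ⊗ θ) ⊕ (k ⊗ sc (ℕ→ℚ m))

  leftSpan-isLeftIdeal : ∀ {θ} m → H θ → IsLeftIdeal H (LeftSpan θ m)
  leftSpan-isLeftIdeal {θ} m θ∈H = record
    { sub = λ { (span h k h∈H k∈H refl) → add∈ (mul∈ h∈H θ∈H) (mul∈ k∈H (sc-ℕ-∈ m)) }
    ; zero∈ = span 0H 0H zero∈ zero∈ (sym (trans (cong₂ _⊕_ (⊗-zeroˡ θ) (⊗-zeroˡ μ)) (⊕-identityˡ 0H)))
    ; add∈ = λ { (span h k h∈H k∈H refl) (span h′ k′ h′∈H k′∈H refl) →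
        span (h ⊕ h′) (k ⊕ k′) (add∈ h∈H h′∈H) (add∈ k∈H k′∈H)
          (trans (⊕-interchange (h ⊗ θ) (k ⊗ μ) (h′ ⊗ θ) (k′ ⊗ μ))
                 (sym (cong₂ _⊕_ (⊗-distribʳ h h′ θ) (⊗-distribʳ k k′ μ)))) }
    ; neg∈ = λ { (span h k h∈H k∈H refl) →
        span (⊖ h) (⊖ k) (neg∈ h∈H) (neg∈ k∈H)
          (trans (⊖-⊕ (h ⊗ θ) (k ⊗ μ)) (sym (cong₂ _⊕_ (⊖-⊗ h θ) (⊖-⊗ k μ)))) }
    ; lmul∈ = λ { {g} g∈H (span h k h∈H k∈H refl) →
        span (g ⊗ h) (g ⊗ k) (mul∈ g∈H h∈H) (mul∈ g∈H k∈H)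
          (trans (⊗-distribˡ g (h ⊗ θ) (k ⊗ μ)) (sym (cong₂ _⊕_ (⊗-assoc g h θ) (⊗-assoc g k μ)))) }
    }
    where μ = sc (ℕ→ℚ m)

  θ∈leftSpan : ∀ {θ} m → LeftSpan θ m θ
  θ∈leftSpan {θ} m = span 1H 0H one∈ zero∈
    (sym (trans (cong₂ _⊕_ (⊗-identityˡ θ) (⊗-zeroˡ (sc (ℕ→ℚ m)))) (⊕-identityʳ θ)))

  m∈leftSpan : ∀ {θ} m → LeftSpan θ m (sc (ℕ→ℚ m))
  m∈leftSpan {θ} m = span 0H 1H zero∈ one∈
    (sym (trans (cong₂ _⊕_ (⊗-zeroˡ θ) (⊗-identityˡ (sc (ℕ→ℚ m)))) (⊕-identityˡ (sc (ℕ→ℚ m)))))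

  leftSpan-scale : ∀ {θ x} m n → LeftSpan θ m x → LeftSpan θ (m ℕ.* n) (sc (ℕ→ℚ n) ⊗ x)
  leftSpan-scale {θ} m n (span h k h∈H k∈H refl) = span (ν ⊗ h) k (mul∈ (sc-ℕ-∈ n) h∈H) k∈H
    (trans (⊗-distribˡ ν (h ⊗ θ) (k ⊗ sc (ℕ→ℚ m)))
           (cong₂ _⊕_ (sym (⊗-assoc ν h θ))
                      (trans (sc-⊗-⊗-sc (ℕ→ℚ n) k (ℕ→ℚ m)) (cong (λ q → k ⊗ sc q) (sym (ℕ→ℚ-* m n))))))
    where ν = sc (ℕ→ℚ n)

  -- Multiplying 1 = hθ + km on the right by θ̄ gives θ̄ = h·N(θ) + k·m·θ̄, a multiple of m.
  1∈leftSpan⇒multiple : ∀ {θ} m → H θ → m ∣N θ → LeftSpan θ m 1H →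
                        Σ Quat λ η → H η × θ ≡ ℕ→ℚ m · η
  1∈leftSpan⇒multiple {θ} m θ∈H (j , Nθ≡mj) (span h k h∈H k∈H 1≡hθ+km) =
    conj η , conj-∈ η∈H , trans (sym (conj-involutive θ)) (trans (cong conj θ̄≡mη) (conj-· (ℕ→ℚ m) η))
    where
    μ = sc (ℕ→ℚ m)
    η = (h ⊗ sc (ℤ→ℚ j)) ⊕ (k ⊗ conj θ)
    η∈H : H η
    η∈H = add∈ (mul∈ h∈H (sc-ℤ-∈ j)) (mul∈ k∈H (conj-∈ θ∈H))
    factor-out : ∀ p q h k c → (h ⊗ sc (p * q)) ⊕ (k ⊗ (p · c)) ≡ p · ((h ⊗ sc q) ⊕ (k ⊗ c))
    factor-out p q (quat h0 h1 h2 h3) (quat k0 k1 k2 k3) (quat c0 c1 c2 c3) =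
      quat-solve 16 (λ α β p q h0 h1 h2 h3 k0 k1 k2 k3 c0 c1 c2 c3 →
        let open Ops α β
            h = quatᴾ h0 h1 h2 h3; k = quatᴾ k0 k1 k2 k3; c = quatᴾ c0 c1 c2 c3
        in (h ⊗ᴾ scᴾ (p :* q)) ⊕ᴾ (k ⊗ᴾ (p ·ᴾ c)) , p ·ᴾ ((h ⊗ᴾ scᴾ q) ⊕ᴾ (k ⊗ᴾ c)))
        refl a b p q h0 h1 h2 h3 k0 k1 k2 k3 c0 c1 c2 c3
    open ≡-Reasoning
    θ̄≡mη : conj θ ≡ ℕ→ℚ m · η
    θ̄≡mη = begin
      conj θ
        ≡⟨ ⊗-identityˡ (conj θ) ⟨
      1H ⊗ conj θ
        ≡⟨ cong (_⊗ conj θ) 1≡hθ+km ⟩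
      ((h ⊗ θ) ⊕ (k ⊗ μ)) ⊗ conj θ
        ≡⟨ ⊗-distribʳ (h ⊗ θ) (k ⊗ μ) (conj θ) ⟩
      ((h ⊗ θ) ⊗ conj θ) ⊕ ((k ⊗ μ) ⊗ conj θ)
        ≡⟨ cong₂ _⊕_ (⊗-assoc h θ (conj θ)) (⊗-assoc k μ (conj θ)) ⟩
      (h ⊗ (θ ⊗ conj θ)) ⊕ (k ⊗ (μ ⊗ conj θ))
        ≡⟨ cong₂ _⊕_ (cong (h ⊗_) (trans (⊗-conjʳ θ) (cong sc Nθ≡mj)))
                     (cong (k ⊗_) (sc-⊗ (ℕ→ℚ m) (conj θ))) ⟩
      (h ⊗ sc (ℕ→ℚ m * ℤ→ℚ j)) ⊕ (k ⊗ (ℕ→ℚ m · conj θ))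
        ≡⟨ factor-out (ℕ→ℚ m) (ℤ→ℚ j) h k (conj θ) ⟩
      ℕ→ℚ m · η
        ∎

  -- γ ∈ Hθ + Hm is what makes γ unique up to left units (rightFactor-unique).
  record RightFactor (θ : Quat) (m : ℕ) : Set where
    field
      γ f : Quat
      γ∈H : H γ
      f∈H : H f
      θ≡fγ : θ ≡ f ⊗ γ
      N-γ : N γ ≡ ℕ→ℚ m
      γ∈span : LeftSpan θ m γ

  generator⇒rightFactor : ∀ {θ p γ} → Prime p → Primitive H θ → p ∣N θ → H γ →
    RightDivides H γ θ → RightDivides H γ (sc (ℕ→ℚ p)) → LeftSpan θ p γ → RightFactor θ p
  generator⇒rightFactor {θ} {p} {γ} p-prime prim p∣Nθ γ∈H (f , f∈H , θ≡fγ) (g , g∈H , p≡gγ) γ∈span =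
    classify (factors-of-p² p-prime (ℕ→ℚ-injective Ng*Nγ≡p²))
    where
    open ≡-Reasoning
    ng = proj₁ (N-natural g∈H)
    nγ = proj₁ (N-natural γ∈H)
    Ng≡ng = proj₂ (N-natural g∈H)
    Nγ≡nγ = proj₂ (N-natural γ∈H)

    Ng*Nγ≡p² : ℕ→ℚ (ng ℕ.* nγ) ≡ ℕ→ℚ (p ℕ.* p)
    Ng*Nγ≡p² = begin
      ℕ→ℚ (ng ℕ.* nγ)     ≡⟨ ℕ→ℚ-* ng nγ ⟩
      ℕ→ℚ ng * ℕ→ℚ nγ     ≡⟨ cong₂ _*_ Ng≡ng Nγ≡nγ ⟨
      N g * N γ           ≡⟨ N-⊗ g γ ⟨
      N (g ⊗ γ)           ≡⟨ cong N p≡gγ ⟨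
      N (sc (ℕ→ℚ p))      ≡⟨ N-sc (ℕ→ℚ p) ⟩
      ℕ→ℚ p * ℕ→ℚ p       ≡⟨ ℕ→ℚ-* p p ⟨
      ℕ→ℚ (p ℕ.* p)       ∎

    γ-unit⇒1∈leftSpan : nγ ≡ 1 → LeftSpan θ p 1H
    γ-unit⇒1∈leftSpan nγ≡1 = subst (LeftSpan θ p)
      (trans (⊗-conjˡ γ) (cong sc (trans Nγ≡nγ (cong ℕ→ℚ nγ≡1))))
      (IsLeftIdeal.lmul∈ (leftSpan-isLeftIdeal p (proj₁ prim)) (conj-∈ γ∈H) γ∈span)

    g-unit⇒γ≡p·ḡ : ng ≡ 1 → γ ≡ ℕ→ℚ p · conj g
    g-unit⇒γ≡p·ḡ ng≡1 = begin
      γ                       ≡⟨ ⊗-identityˡ γ ⟨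
      1H ⊗ γ                  ≡⟨ cong (_⊗ γ) (trans (⊗-conjˡ g) (cong sc (trans Ng≡ng (cong ℕ→ℚ ng≡1)))) ⟨
      (conj g ⊗ g) ⊗ γ        ≡⟨ ⊗-assoc (conj g) g γ ⟩
      conj g ⊗ (g ⊗ γ)        ≡⟨ cong (conj g ⊗_) p≡gγ ⟨
      conj g ⊗ sc (ℕ→ℚ p)     ≡⟨ ⊗-sc (conj g) (ℕ→ℚ p) ⟩
      ℕ→ℚ p · conj g          ∎

    classify : nγ ≡ p ⊎ nγ ≡ 1 ⊎ ng ≡ 1 → RightFactor θ p
    classify (inj₁ nγ≡p) = record
      { γ∈H = γ∈H ; f∈H = f∈H ; θ≡fγ = θ≡fγ
      ; N-γ = trans Nγ≡nγ (cong ℕ→ℚ nγ≡p) ; γ∈span = γ∈span }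
    classify (inj₂ (inj₁ nγ≡1)) =
      let η , η∈H , θ≡pη = 1∈leftSpan⇒multiple p (proj₁ prim) p∣Nθ (γ-unit⇒1∈leftSpan nγ≡1)
      in ⊥-elim (primitive⇒≢prime-multiple prim p-prime η∈H θ≡pη)
    classify (inj₂ (inj₂ ng≡1)) = ⊥-elim (primitive⇒≢prime-multiple prim p-prime (mul∈ f∈H (conj-∈ g∈H))
      (trans θ≡fγ (trans (cong (f ⊗_) (g-unit⇒γ≡p·ḡ ng≡1)) (⊗-· (ℕ→ℚ p) f (conj g)))))

  prime-rightFactor : IsLeftPID H → ∀ {θ p} → Prime p → Primitive H θ → p ∣N θ → RightFactor θ p
  prime-rightFactor pid {θ} {p} p-prime prim p∣Nθ with pid (LeftSpan θ p) (leftSpan-isLeftIdeal p (proj₁ prim))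
  ... | γ , γ∈H , generates = generator⇒rightFactor p-prime prim p∣Nθ γ∈H
    (proj₁ (generates θ) (θ∈leftSpan p))
    (proj₁ (generates (sc (ℕ→ℚ p))) (m∈leftSpan p))
    (proj₂ (generates γ) (1H , one∈ , sym (⊗-identityˡ γ)))

  rightFactor-compose : ∀ {θ m n} (F : RightFactor θ m) → RightFactor (RightFactor.f F) n →
                        RightFactor θ (m ℕ.* n)
  rightFactor-compose {θ} {m} {n} F₁ F₂ = record
    { γ∈H = mul∈ γ₂∈H γ₁∈H
    ; f∈H = f₂∈H
    ; θ≡fγ = trans θ≡f₁γ₁ (trans (cong (_⊗ γ₁) f₁≡f₂γ₂) (⊗-assoc f₂ γ₂ γ₁))
    ; N-γ = trans (N-⊗ γ₂ γ₁)
                  (trans (cong₂ _*_ Nγ₂ Nγ₁) (trans (ℚ.*-comm (ℕ→ℚ n) (ℕ→ℚ m)) (sym (ℕ→ℚ-* m n))))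
    ; γ∈span = subst (LeftSpan θ (m ℕ.* n)) (sym γ₂γ₁≡)
                 (Span.add∈ (Span.lmul∈ h∈H (θ∈leftSpan (m ℕ.* n)))
                            (Span.lmul∈ k∈H (leftSpan-scale m n γ₁∈span)))
    }
    where
    open RightFactor F₁
      renaming (γ to γ₁; f to f₁; γ∈H to γ₁∈H; θ≡fγ to θ≡f₁γ₁; N-γ to Nγ₁; γ∈span to γ₁∈span)
    open RightFactor F₂
      renaming ( γ to γ₂; f to f₂; γ∈H to γ₂∈H; f∈H to f₂∈H; θ≡fγ to f₁≡f₂γ₂; N-γ to Nγ₂
               ; γ∈span to γ₂∈span)
    open LeftSpan γ₂∈span
    module Span = IsLeftIdeal (leftSpan-isLeftIdeal (m ℕ.* n) (subst H (sym θ≡f₁γ₁) (mul∈ f∈H γ₁∈H)))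
    ν = sc (ℕ→ℚ n)
    γ₂γ₁≡ : γ₂ ⊗ γ₁ ≡ (h ⊗ θ) ⊕ (k ⊗ (ν ⊗ γ₁))
    γ₂γ₁≡ = begin
      γ₂ ⊗ γ₁
        ≡⟨ cong (_⊗ γ₁) x≡hθ+km ⟩
      ((h ⊗ f₁) ⊕ (k ⊗ ν)) ⊗ γ₁
        ≡⟨ ⊗-distribʳ (h ⊗ f₁) (k ⊗ ν) γ₁ ⟩
      ((h ⊗ f₁) ⊗ γ₁) ⊕ ((k ⊗ ν) ⊗ γ₁)
        ≡⟨ cong₂ _⊕_ (⊗-assoc h f₁ γ₁) (⊗-assoc k ν γ₁) ⟩
      (h ⊗ (f₁ ⊗ γ₁)) ⊕ (k ⊗ (ν ⊗ γ₁))
        ≡⟨ cong (λ t → (h ⊗ t) ⊕ (k ⊗ (ν ⊗ γ₁))) θ≡f₁γ₁ ⟨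
      (h ⊗ θ) ⊕ (k ⊗ (ν ⊗ γ₁))
        ∎
      where open ≡-Reasoning

  rightFactor-∏ : IsLeftPID H → ∀ {θ} ps → All Prime ps → Primitive H θ →
                  product ps ∣N θ → RightFactor θ (product ps)
  rightFactor-∏ pid {θ} [] [] prim _ = record
    { γ∈H = one∈ ; f∈H = proj₁ prim ; θ≡fγ = sym (⊗-identityʳ θ)
    ; N-γ = N-sc 1ℚ ; γ∈span = m∈leftSpan 1 }
  rightFactor-∏ pid {θ} (p ∷ ps) (p-prime ∷ ps-prime) prim p∏ps∣Nθ =
    rightFactor-compose F (rightFactor-∏ pid ps ps-prime (primitive-cofactor prim f∈H γ∈H θ≡fγ)
                                                       (∣N-cofactor p (product ps) f γ p∏ps∣Nθ θ≡fγ N-γ))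
    where
    instance _ = prime⇒nonZero p-prime
    F = prime-rightFactor pid p-prime prim (∣N-*ʳ p (product ps) {θ} p∏ps∣Nθ)
    open RightFactor F

  rightFactor : IsLeftPID H → ∀ {θ} m → Primitive H θ → m ∣N θ → RightFactor θ m
  rightFactor pid {θ} m prim m∣Nθ = subst (RightFactor θ) (sym isFactorisation)
    (rightFactor-∏ pid factors factorsPrime prim (subst (_∣N θ) isFactorisation m∣Nθ))
    where
    instance _ = ℕ.≢-nonZero (primitive⇒∣N≢0 m prim m∣Nθ)
    open PrimeFactorisation (factorise m)

  rightFactor-unique : ∀ {θ m} .{{_ : ℕ.NonZero m}} (F : RightFactor θ m) → ∀ δ → H δ → N δ ≡ ℕ→ℚ m →
    RightDivides H δ θ → Σ Quat λ u → IsUnit H u × RightFactor.γ F ≡ u ⊗ δ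
  rightFactor-unique {θ} {m} F δ δ∈H Nδ≡m (f′ , f′∈H , θ≡f′δ) = u , N≡1⇒isUnit u∈H Nu≡1 , γ≡uδ
    where
    open RightFactor F
    open LeftSpan γ∈span
    open ≡-Reasoning
    u = (h ⊗ f′) ⊕ (k ⊗ conj δ)
    u∈H : H u
    u∈H = add∈ (mul∈ h∈H f′∈H) (mul∈ k∈H (conj-∈ δ∈H))
    γ≡uδ : γ ≡ u ⊗ δ
    γ≡uδ = begin
      γ
        ≡⟨ x≡hθ+km ⟩
      (h ⊗ θ) ⊕ (k ⊗ sc (ℕ→ℚ m))
        ≡⟨ cong₂ _⊕_ (cong (h ⊗_) θ≡f′δ) (cong (λ t → k ⊗ sc t) (sym Nδ≡m)) ⟩
      (h ⊗ (f′ ⊗ δ)) ⊕ (k ⊗ sc (N δ))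
        ≡⟨ cong (λ t → (h ⊗ (f′ ⊗ δ)) ⊕ (k ⊗ t)) (⊗-conjˡ δ) ⟨
      (h ⊗ (f′ ⊗ δ)) ⊕ (k ⊗ (conj δ ⊗ δ))
        ≡⟨ cong₂ _⊕_ (⊗-assoc h f′ δ) (⊗-assoc k (conj δ) δ) ⟨
      ((h ⊗ f′) ⊗ δ) ⊕ ((k ⊗ conj δ) ⊗ δ)
        ≡⟨ ⊗-distribʳ (h ⊗ f′) (k ⊗ conj δ) δ ⟨
      u ⊗ δ
        ∎
    Nu≡1 : N u ≡ 1ℚ
    Nu≡1 = *-cancelˡ-≡ (ℕ→ℚ m) {{ℕ→ℚ-nonZero m}} (begin
      ℕ→ℚ m * N u       ≡⟨ ℚ.*-comm (ℕ→ℚ m) (N u) ⟩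
      N u * ℕ→ℚ m       ≡⟨ cong (N u *_) Nδ≡m ⟨
      N u * N δ         ≡⟨ N-⊗ u δ ⟨
      N (u ⊗ δ)         ≡⟨ cong N γ≡uδ ⟨
      N γ               ≡⟨ N-γ ⟩
      ℕ→ℚ m             ≡⟨ ℚ.*-identityʳ (ℕ→ℚ m) ⟨
      ℕ→ℚ m * 1ℚ        ∎)

  rightDivisor-exists-unique : IsLeftPID H → ∀ {θ} → Primitive H θ → ∀ m → m ∣N θ →
    Σ Quat λ γ → H γ × N γ ≡ ℤ→ℚ (+ m) × RightDivides H γ θ ×
      (∀ δ → H δ → N δ ≡ ℤ→ℚ (+ m) → RightDivides H δ θ → Σ Quat λ u → IsUnit H u × γ ≡ u ⊗ δ)
  rightDivisor-exists-unique pid prim m m∣Nθ = γ , γ∈H , N-γ , (f , f∈H , θ≡fγ) , rightFactor-unique F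
    where
    instance _ = ℕ.≢-nonZero (primitive⇒∣N≢0 m prim m∣Nθ)
    F = rightFactor pid m prim m∣Nθ
    open RightFactor F

module LeftDivisors (a b : ℚ) .{{_ : Positive a}} .{{_ : Positive b}} {H : Quat → Set}
                    (order : QuatAlg.IsOrder a b H) where
  open QuatAlg a b
  open QuaternionLaws a b
  open Order a b order
  open RightDivisors a b order using (rightDivisor-exists-unique)

  conj-leftIdeal : ∀ {I} → IsLeftIdeal H I → IsRightIdeal H (λ x → I (conj x))
  conj-leftIdeal {I} I-ideal = record
    { sub = λ {x} I∋x̄ → subst H (conj-involutive x) (conj-∈ (I.sub I∋x̄))
    ; zero∈ = I.zero∈
    ; add∈ = λ {x} {y} I∋x̄ I∋ȳ → subst I (sym (conj-⊕ x y)) (I.add∈ I∋x̄ I∋ȳ)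
    ; neg∈ = λ {x} I∋x̄ → subst I (sym (conj-⊖ x)) (I.neg∈ I∋x̄)
    ; rmul∈ = λ {h} {x} h∈H I∋x̄ → subst I (sym (conj-⊗ x h)) (I.lmul∈ (conj-∈ h∈H) I∋x̄)
    }
    where module I = IsLeftIdeal I-ideal

  rightPID⇒leftPID : IsRightPID H → IsLeftPID H
  rightPID⇒leftPID rpid I I-ideal = conj γ , conj-∈ γ∈H , λ x → into x , onto x
    where
    generator = rpid (λ x → I (conj x)) (conj-leftIdeal I-ideal)
    γ = proj₁ generator
    γ∈H = proj₁ (proj₂ generator)
    generates = proj₂ (proj₂ generator)
    into : ∀ x → I x → Σ Quat λ h → H h × x ≡ h ⊗ conj γ
    into x I∋x = conj-cofactor (proj₁ (generates (conj x)) (subst I (sym (conj-involutive x)) I∋x))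
      where
      conj-cofactor : (Σ Quat λ h → H h × conj x ≡ γ ⊗ h) → Σ Quat λ h → H h × x ≡ h ⊗ conj γ
      conj-cofactor (h , h∈H , x̄≡γh) = conj h , conj-∈ h∈H ,
        trans (sym (conj-involutive x)) (trans (cong conj x̄≡γh) (conj-⊗ γ h))
    onto : ∀ x → (Σ Quat λ h → H h × x ≡ h ⊗ conj γ) → I x
    onto x (h , h∈H , x≡hγ̄) = subst I (conj-involutive x) (proj₂ (generates (conj x))
      (conj h , conj-∈ h∈H ,
       trans (cong conj x≡hγ̄) (trans (conj-⊗ h (conj γ)) (cong (_⊗ conj h) (conj-involutive γ)))))

  primitive-conj : ∀ {θ} → Primitive H θ → Primitive H (conj θ)
  primitive-conj {θ} (θ∈H , only-units) = conj-∈ θ∈H , λ n η η∈H θ̄≡nη →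
    only-units n (conj η) (conj-∈ η∈H)
      (trans (sym (conj-involutive θ)) (trans (cong conj θ̄≡nη) (conj-· (ℤ→ℚ n) η)))

  isUnit-conj : ∀ {u} → IsUnit H u → IsUnit H (conj u)
  isUnit-conj {u} (u∈H , v , v∈H , uv≡1 , vu≡1) = conj-∈ u∈H , conj v , conj-∈ v∈H ,
    trans (sym (conj-⊗ v u)) (trans (cong conj vu≡1) (conj-sc 1ℚ)) ,
    trans (sym (conj-⊗ u v)) (trans (cong conj uv≡1) (conj-sc 1ℚ))

  leftDivides⇒rightDivides-conj : ∀ {δ θ} → LeftDivides H δ θ → RightDivides H (conj δ) (conj θ)
  leftDivides⇒rightDivides-conj {δ} (f , f∈H , θ≡δf) =
    conj f , conj-∈ f∈H , trans (cong conj θ≡δf) (conj-⊗ δ f)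

  rightDivides-conj⇒leftDivides : ∀ {γ θ} → RightDivides H γ (conj θ) → LeftDivides H (conj γ) θ
  rightDivides-conj⇒leftDivides {γ} {θ} (f , f∈H , θ̄≡fγ) = conj f , conj-∈ f∈H ,
    trans (sym (conj-involutive θ)) (trans (cong conj θ̄≡fγ) (conj-⊗ f γ))

  leftDivisor-exists-unique : IsRightPID H → ∀ {θ} → Primitive H θ → ∀ m → m ∣N θ →
    Σ Quat λ γ → H γ × N γ ≡ ℤ→ℚ (+ m) × LeftDivides H γ θ ×
      (∀ δ → H δ → N δ ≡ ℤ→ℚ (+ m) → LeftDivides H δ θ → Σ Quat λ u → IsUnit H u × γ ≡ δ ⊗ u)
  leftDivisor-exists-unique rpid {θ} prim m (k , Nθ≡mk) =
    conj γ , conj-∈ γ∈H , trans (N-conj γ) Nγ≡m , rightDivides-conj⇒leftDivides γ∣θ̄ , unique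
    where
    for-conj = rightDivisor-exists-unique (rightPID⇒leftPID rpid) (primitive-conj prim) m (k , trans (N-conj θ) Nθ≡mk)
    γ = proj₁ for-conj
    γ∈H = proj₁ (proj₂ for-conj)
    Nγ≡m = proj₁ (proj₂ (proj₂ for-conj))
    γ∣θ̄ = proj₁ (proj₂ (proj₂ (proj₂ for-conj)))
    unique-for-conj = proj₂ (proj₂ (proj₂ (proj₂ for-conj)))
    conj-unit : ∀ {δ} → (Σ Quat λ u → IsUnit H u × γ ≡ u ⊗ conj δ) →
                Σ Quat λ u → IsUnit H u × conj γ ≡ δ ⊗ u
    conj-unit {δ} (u , u-unit , γ≡uδ̄) = conj u , isUnit-conj u-unit ,
      trans (cong conj γ≡uδ̄) (trans (conj-⊗ u (conj δ)) (cong (_⊗ conj u) (conj-involutive δ)))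
    unique : ∀ δ → H δ → N δ ≡ ℤ→ℚ (+ m) → LeftDivides H δ θ →
             Σ Quat λ u → IsUnit H u × conj γ ≡ δ ⊗ u
    unique δ δ∈H Nδ≡m δ∣θ = conj-unit
      (unique-for-conj (conj δ) (conj-∈ δ∈H) (trans (N-conj δ) Nδ≡m) (leftDivides⇒rightDivides-conj δ∣θ))

theorem2p2 : (a b : ℚ) → Positive a → Positive b →
    let open QuatAlg a b in
    (H : Quat → Set) → IsOrder H →
    (θ : Quat) → Primitive H θ → (m : ℕ) → m ∣N θ →
    (IsLeftPID H →
      Σ Quat λ γ → H γ × N γ ≡ ℤ→ℚ (+ m) × RightDivides H γ θ ×
        (∀ δ → H δ → N δ ≡ ℤ→ℚ (+ m) → RightDivides H δ θ →
          Σ Quat λ u → IsUnit H u × γ ≡ u ⊗ δ))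
    ×
    (IsRightPID H →
      Σ Quat λ γ → H γ × N γ ≡ ℤ→ℚ (+ m) × LeftDivides H γ θ ×
        (∀ δ → H δ → N δ ≡ ℤ→ℚ (+ m) → LeftDivides H δ θ →
          Σ Quat λ u → IsUnit H u × γ ≡ δ ⊗ u))
theorem2p2 a b a>0 b>0 H order θ prim m m∣Nθ =
  (λ pid → rightDivisor-exists-unique pid prim m m∣Nθ) ,
  (λ rpid → leftDivisor-exists-unique rpid prim m m∣Nθ)
  where
  open RightDivisors a b {{a>0}} {{b>0}} order using (rightDivisor-exists-unique)
  open LeftDivisors a b {{a>0}} {{b>0}} order using (leftDivisor-exists-unique)
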